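{- Let $v=v_1\cdots v_n$ be a word of distinct positive integers avoiding $31425,32415,31524,32514$. Let the left-to-right maxima of $v$ be at positions $a_1<\dots<a_h$ and the right-to-left maxima at positions $b_1<\dots<b_g$, so $1=a_1$, $a_h=b_1$, $b_g=n$. Suppose $h>1$, $g>1$, $a_h>h$ and $v_{a_{h-1}}<v_{b_2}$. Then one of the following holds: (A-1) $a_h=a_{h-1}+1$; (A-2) $a_h>a_{h-1}+1$ and $b_2=a_h+1$; (A-3) $a_h>a_{h-1}+1$, $b_2>a_h+1$, and $v_j>v_{a_{h-1}}$ for all $a_h<j<b_2$.
   Context: A word avoids a pattern $P$ if it has no subsequence order-isomorphic to $P$. A left-to-right (resp. right-to-left) maximum of $v$ is an entry larger than all entries to its left (resp. right). -}

module Defs where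

open import Data.Nat using (ℕ; _<_; _<?_)
open import Data.Fin as F using (Fin; toℕ)
open import Data.Fin.Properties using (all?)
open import Data.Vec using (Vec; []; _∷_; lookup)
open import Data.List using (List; length; filter; allFin)
open import Data.Product using (Σ; _×_)
open import Function.Bundles using (_⇔_)
open import Relation.Nullary using (Dec; ¬_)
open import Relation.Nullary.Decidable using (_→-dec_)

-- A word of length n is a function Fin n → ℕ (position i is 0-indexed
-- here; paper position = toℕ i + 1).
Word : ℕ → Set
Word n = Fin n → ℕ

Contains : ∀ {k n} → Word k → Word n → Set
Contains {k} {n} P v =
  Σ (Fin k → Fin n) λ f →
    (∀ i j → i F.< j → f i F.< f j) ×
    (∀ i j → (P i < P j) ⇔ (v (f i) < v (f j)))

Avoids : ∀ {k n} → Word k → Word n → Set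
Avoids P v = ¬ Contains P v

pat : Vec ℕ 5 → Word 5
pat = lookup

p31425 p32415 p31524 p32514 : Word 5
p31425 = pat (3 ∷ 1 ∷ 4 ∷ 2 ∷ 5 ∷ [])
p32415 = pat (3 ∷ 2 ∷ 4 ∷ 1 ∷ 5 ∷ [])
p31524 = pat (3 ∷ 1 ∷ 5 ∷ 2 ∷ 4 ∷ [])
p32514 = pat (3 ∷ 2 ∷ 5 ∷ 1 ∷ 4 ∷ [])

IsLRMax : ∀ {n} → Word n → Fin n → Set
IsLRMax v i = ∀ j → j F.< i → v j < v i

IsRLMax : ∀ {n} → Word n → Fin n → Set
IsRLMax v i = ∀ j → i F.< j → v j < v i

isLRMax? : ∀ {n} (v : Word n) i → Dec (IsLRMax v i)
isLRMax? v i = all? (λ j → (j F.<? i) →-dec (v j <? v i))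

lrCount : ∀ {n} → Word n → ℕ
lrCount {n} v = length (filter (isLRMax? v) (allFin n))

-- The last left-to-right maximum a_h carries the maximum M of v and precedes every
-- right-to-left maximum, so a_h < b_2 and w = v_{b_2} < M. If a_{h-1} and a_h are
-- not adjacent, the entry y right after a_{h-1} is smaller than x = v_{a_{h-1}},
-- for otherwise it would be a left-to-right maximum before a_h. If some entry
-- z = v_j with a_h < j < b_2 were smaller than x, then x y M z w (with x < w)
-- would be an occurrence of 31524 (y < z) or 32514 (z < y).
module Submission where

open import Defs
open import Data.Nat using (ℕ; suc; _<_; _≤_; z≤n; s≤s)
import Data.Nat as Nat
open import Data.Nat.Properties
  using (<-trans; <-asym; <-irrefl; ≤-refl; ≤-reflexive; ≤-trans; <⇒≤; ≤-<-trans;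
         ≤∧≢⇒<; ≮⇒≥; <⇒≱; <-cmp; ≤-pred; suc-injective)
open import Data.Fin using (Fin; toℕ; #_)
open import Data.Fin renaming (_<_ to _<ᶠ_; _≤_ to _≤ᶠ_)
import Data.Fin.Properties as Fin
open import Data.Fin.Properties using (all?; any?)
open import Data.List using (allFin)
open import Data.List.Extrema.Nat using (argmax; f[xs]≤f[argmax])
open import Data.List.Membership.Propositional.Properties using (∈-allFin)
import Data.List.Relation.Unary.All as All
open import Data.Vec using (_∷_; []; lookup)
open import Data.Product using (_×_; ∃; _,_)
open import Data.Sum using (_⊎_; inj₁; inj₂; [_,_])
open import Data.Empty using (⊥-elim)
open import Function using (_∘_)
open import Function.Bundles using (mk⇔)
open import Function.Definitions using (Injective)
open import Relation.Binary using (Tri; tri<; tri≈; tri>)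
open import Relation.Binary.PropositionalEquality
  using (_≡_; _≢_; refl; sym; trans; cong; subst; subst₂)
open import Relation.Nullary using (¬_; Dec; yes; no)
open import Relation.Nullary.Decidable using (from-yes; decidable-stable)

StepwiseIncreasing : ∀ {m} → (Fin (suc m) → ℕ) → Set
StepwiseIncreasing h = ∀ r → h (inject₁ r) < h (suc r)

stepwise⇒strictlyIncreasing : ∀ {m} (h : Fin (suc m) → ℕ) → StepwiseIncreasing h →
  ∀ {r s} → r <ᶠ s → h r < h s
stepwise⇒strictlyIncreasing {suc m} h step {zero} {suc zero} _ = step zero
stepwise⇒strictlyIncreasing {suc m} h step {zero} {suc (suc s)} _ =
  <-trans (step zero) (stepwise⇒strictlyIncreasing (h ∘ suc) (step ∘ suc) {zero} {suc s} (s≤s z≤n))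
stepwise⇒strictlyIncreasing {suc m} h step {suc r} {suc s} (s≤s r<s) =
  stepwise⇒strictlyIncreasing (h ∘ suc) (step ∘ suc) r<s

record ListsByValue {k} (P : Word k) (σ : Fin k → Fin k) : Set where
  field
    value : ∀ r → P (σ r) ≡ suc (toℕ r)
    onto  : ∀ i → ∃ λ r → σ r ≡ i

  value-order : ∀ {r s} → P (σ r) < P (σ s) → r <ᶠ s
  value-order {r} {s} = ≤-pred ∘ subst₂ _<_ (value r) (value s)

  injective : ∀ {i j} → P i ≡ P j → i ≡ j
  injective {i} {j} Pi≡Pj with onto i | onto j
  ... | r , refl | s , refl =
    cong σ (Fin.toℕ-injective (suc-injective (trans (sym (value r)) (trans Pi≡Pj (value s)))))

contains-byValue : ∀ {m n} {P : Word (suc m)} {σ} → ListsByValue P σ →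
  (v : Word n) (f : Fin (suc m) → Fin n) →
  StepwiseIncreasing (toℕ ∘ f) → StepwiseIncreasing (v ∘ f ∘ σ) → Contains P v
contains-byValue {P = P} {σ} byValue v f positions values =
  f , (λ _ _ → stepwise⇒strictlyIncreasing (toℕ ∘ f) positions) , λ i j → mk⇔ (forward i j) (backward i j)
  where
  open ListsByValue byValue
  forward : ∀ i j → P i < P j → v (f i) < v (f j)
  forward i j with onto i | onto j
  ... | r , refl | s , refl = stepwise⇒strictlyIncreasing (v ∘ f ∘ σ) values ∘ value-order
  backward : ∀ i j → v (f i) < v (f j) → P i < P j
  backward i j q with <-cmp (P i) (P j)
  ... | tri< Pi<Pj _ _ = Pi<Pj
  ... | tri≈ _ Pi≡Pj _ = ⊥-elim (<-irrefl (cong (v ∘ f) (injective Pi≡Pj)) q)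
  ... | tri> _ _ Pj<Pi = ⊥-elim (<-asym q (forward j i Pj<Pi))

sorted-31524 sorted-32514 : Fin 5 → Fin 5
sorted-31524 = lookup (# 1 ∷ # 3 ∷ # 0 ∷ # 4 ∷ # 2 ∷ [])
sorted-32514 = lookup (# 3 ∷ # 1 ∷ # 0 ∷ # 4 ∷ # 2 ∷ [])

listsByValue-31524 : ListsByValue p31524 sorted-31524
listsByValue-31524 = record
  { value = from-yes (all? λ r → p31524 (sorted-31524 r) Nat.≟ suc (toℕ r))
  ; onto  = from-yes (all? λ i → any? λ r → sorted-31524 r Fin.≟ i)
  }

listsByValue-32514 : ListsByValue p32514 sorted-32514
listsByValue-32514 = record
  { value = from-yes (all? λ r → p32514 (sorted-32514 r) Nat.≟ suc (toℕ r))
  ; onto  = from-yes (all? λ i → any? λ r → sorted-32514 r Fin.≟ i)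
  }

contains-31524-or-32514 : ∀ {n} (v : Word n) → Injective _≡_ _≡_ v →
  ∀ {p₁ p₂ p₃ p₄ p₅} → p₁ <ᶠ p₂ → p₂ <ᶠ p₃ → p₃ <ᶠ p₄ → p₄ <ᶠ p₅ →
  v p₂ < v p₁ → v p₄ < v p₁ → v p₁ < v p₅ → v p₅ < v p₃ →
  Contains p31524 v ⊎ Contains p32514 v
contains-31524-or-32514 v inj {p₁} {p₂} {p₃} {p₄} {p₅} p₁<p₂ p₂<p₃ p₃<p₄ p₄<p₅ y<x z<x x<w w<M =
  byOrderOf (<-cmp (v p₂) (v p₄))
  where
  occurrence : Fin 5 → Fin _
  occurrence = lookup (p₁ ∷ p₂ ∷ p₃ ∷ p₄ ∷ p₅ ∷ [])
  positions : StepwiseIncreasing (toℕ ∘ occurrence)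
  positions zero = p₁<p₂
  positions (suc zero) = p₂<p₃
  positions (suc (suc zero)) = p₃<p₄
  positions (suc (suc (suc zero))) = p₄<p₅
  byOrderOf : Tri (v p₂ < v p₄) (v p₂ ≡ v p₄) (v p₄ < v p₂) → Contains p31524 v ⊎ Contains p32514 v
  byOrderOf (tri< y<z _ _) = inj₁ (contains-byValue listsByValue-31524 v occurrence positions
    λ { zero → y<z ; (suc zero) → z<x ; (suc (suc zero)) → x<w ; (suc (suc (suc zero))) → w<M })
  byOrderOf (tri≈ _ y≡z _) = ⊥-elim (Fin.<⇒≢ (<-trans p₂<p₃ p₃<p₄) (inj y≡z))
  byOrderOf (tri> _ _ z<y) = inj₂ (contains-byValue listsByValue-32514 v occurrence positions
    λ { zero → z<y ; (suc zero) → y<x ; (suc (suc zero)) → x<w ; (suc (suc (suc zero))) → w<M })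

injective-≮⇒> : ∀ {n} (v : Word n) → Injective _≡_ _≡_ v → ∀ {i j} → ¬ v i < v j → i ≢ j → v j < v i
injective-≮⇒> v inj v≮ i≢j = ≤∧≢⇒< (≮⇒≥ v≮) (λ e → i≢j (inj (sym e)))

lrMax≤rlMax : ∀ {n} (v : Word n) {a b} → IsLRMax v a → IsRLMax v b → a ≤ᶠ b
lrMax≤rlMax v aLR bRL = ≮⇒≥ λ b<a → <-asym (bRL _ b<a) (aLR _ b<a)

lastLRMax-isMaximum : ∀ {n} (v : Word n) → Injective _≡_ _≡_ v →
  ∀ {a} → IsLRMax v a → (∀ j → IsLRMax v j → j ≤ᶠ a) → ∀ i → v i ≤ v a
lastLRMax-isMaximum {n} v inj {a} aLR aLast i = ≤-trans (maximum i) (maximum≤ (m Fin.≟ a))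
  where
  m : Fin n
  m = argmax v a (allFin n)
  maximum : ∀ i → v i ≤ v m
  maximum i = All.lookup (f[xs]≤f[argmax] {f = v} a (allFin n)) (∈-allFin i)
  mLR : IsLRMax v m
  mLR j j<m = injective-≮⇒> v inj (λ vm<vj → <⇒≱ vm<vj (maximum j)) (Fin.<⇒≢ j<m ∘ sym)
  maximum≤ : Dec (m ≡ a) → v m ≤ v a
  maximum≤ (yes m≡a) = ≤-reflexive (cong v m≡a)
  maximum≤ (no m≢a) = <⇒≤ (aLR m (Fin.≤∧≢⇒< (aLast m mLR) m≢a))

isLRMax-next : ∀ {n} (v : Word n) {i k} → IsLRMax v i → toℕ k ≡ suc (toℕ i) → v i < v k → IsLRMax v k
isLRMax-next v {i} iLR k≡1+i vi<vk j j<k with j Fin.≟ i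
... | yes refl = vi<vk
... | no j≢i = <-trans (iLR j (Fin.≤∧≢⇒< (≤-pred (subst (toℕ j <_) k≡1+i j<k)) j≢i)) vi<vk

descent-after-penultimateLRMax : ∀ {n} (v : Word n) → Injective _≡_ _≡_ v →
  ∀ {i a : Fin n} → IsLRMax v i → (∀ j → IsLRMax v j → j <ᶠ a → j ≤ᶠ i) →
  ∀ {k} → toℕ k ≡ suc (toℕ i) → k <ᶠ a → v k < v i
descent-after-penultimateLRMax v inj {i} iLR iLast {k} k≡1+i k<a =
  decidable-stable (v k Nat.<? v i) λ vk≮vi →
    <⇒≱ i<k (iLast k (isLRMax-next v iLR k≡1+i (injective-≮⇒> v inj vk≮vi (Fin.<⇒≢ i<k ∘ sym))) k<a)
  where
  i<k : i <ᶠ k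
  i<k = subst (toℕ i <_) (sym k≡1+i) ≤-refl

lemma3p10 : ∀ {n} (v : Word n) →
    (∀ i → 0 < v i) →
    Injective _≡_ _≡_ v →
    Avoids p31425 v → Avoids p32415 v → Avoids p31524 v → Avoids p32514 v →
    -- ah : the last left-to-right maximum (a_h)
    (ah : Fin n) → IsLRMax v ah → (∀ j → IsLRMax v j → j ≤ᶠ ah) →
    -- b1 : the first right-to-left maximum (b_1)
    (b1 : Fin n) → IsRLMax v b1 → (∀ j → IsRLMax v j → b1 ≤ᶠ j) →
    -- ah1 : a_{h-1}, exists iff h > 1
    (ah1 : Fin n) → IsLRMax v ah1 → ah1 <ᶠ ah →
    (∀ j → IsLRMax v j → j <ᶠ ah → j ≤ᶠ ah1) →
    -- b2 : b_2, exists iff g > 1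
    (b2 : Fin n) → IsRLMax v b2 → b1 <ᶠ b2 →
    (∀ j → IsRLMax v j → b1 <ᶠ j → b2 ≤ᶠ j) →
    -- a_h > h (positions 1-indexed: a_h = toℕ ah + 1)
    lrCount v < suc (toℕ ah) →
    v ah1 < v b2 →
    (toℕ ah ≡ suc (toℕ ah1))
    ⊎ ((suc (toℕ ah1) < toℕ ah) × (toℕ b2 ≡ suc (toℕ ah)))
    ⊎ ((suc (toℕ ah1) < toℕ ah) × (suc (toℕ ah) < toℕ b2)
       × (∀ j → ah <ᶠ j → j <ᶠ b2 → v ah1 < v j))
lemma3p10 v _ inj _ _ avoids31524 avoids32514 ah ahLR ahLast b1 b1RL _ ah1 ah1LR ah1<ah ah1Last b2 _ b1<b2 _ _ x<w
  with toℕ ah Nat.≟ suc (toℕ ah1) | toℕ b2 Nat.≟ suc (toℕ ah)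
... | yes adjacent | _ = inj₁ adjacent
... | no apart | yes b2-next = inj₂ (inj₁ (≤∧≢⇒< ah1<ah (apart ∘ sym) , b2-next))
... | no apart | no b2-far = inj₂ (inj₂ (gap , ≤∧≢⇒< ah<b2 (b2-far ∘ sym) , exceeds))
  where
  gap : suc (toℕ ah1) < toℕ ah
  gap = ≤∧≢⇒< ah1<ah (apart ∘ sym)
  ah<b2 : ah <ᶠ b2
  ah<b2 = ≤-<-trans (lrMax≤rlMax v ahLR b1RL) b1<b2
  w<M : v b2 < v ah
  w<M = ≤∧≢⇒< (lastLRMax-isMaximum v inj ahLR ahLast b2) (Fin.<⇒≢ ah<b2 ∘ sym ∘ inj)
  k : Fin _
  k = fromℕ< (<-trans gap (Fin.toℕ<n ah))
  k≡1+ah1 : toℕ k ≡ suc (toℕ ah1)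
  k≡1+ah1 = Fin.toℕ-fromℕ< (<-trans gap (Fin.toℕ<n ah))
  k<ah : k <ᶠ ah
  k<ah = subst (_< toℕ ah) (sym k≡1+ah1) gap
  ah1<k : ah1 <ᶠ k
  ah1<k = subst (toℕ ah1 <_) (sym k≡1+ah1) ≤-refl
  y<x : v k < v ah1
  y<x = descent-after-penultimateLRMax v inj ah1LR ah1Last k≡1+ah1 k<ah
  exceeds : ∀ j → ah <ᶠ j → j <ᶠ b2 → v ah1 < v j
  exceeds j ah<j j<b2 = decidable-stable (v ah1 Nat.<? v j) λ x≮z →
    [ avoids31524 , avoids32514 ] (contains-31524-or-32514 v inj ah1<k k<ah ah<j j<b2
      y<x (injective-≮⇒> v inj x≮z (Fin.<⇒≢ (<-trans ah1<ah ah<j))) x<w w<M)
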